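{- In the graceful game, Alice has a winning strategy on the complete graph $K_3$ and Bob has a winning strategy on the complete graph $K_4$, no matter who starts.
   Context: A graceful labeling of a graph $G$ with $m$ edges is an injective map $f\colon V(G)\to\{0,1,\dots,m\}$ such that the induced edge labels $|f(u)-f(v)|$, $uv\in E(G)$, are pairwise distinct. The graceful game on a simple graph $G$ with $m$ edges: two players, Alice and Bob, alternately choose a free (not yet labeled) vertex and assign to it a label from $\{0,1,\dots,m\}$ not yet used. An edge both of whose endpoints are labeled gets label $|f(u)-f(v)|$; a move is legal only if after it all edge labels are pairwise distinct. Alice wins if the whole graph ends up gracefully labeled; Bob wins if he can prevent this. Either player may be the first to move. -}

module Defs where

open import Data.Nat using (ℕ; _≤_; _<_; ∣_-_∣)
open import Data.Nat.Properties using (_<?_)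
open import Data.Fin using (Fin; toℕ; _≟_)
open import Data.Fin.Properties using ()
open import Data.List using (List; length; lookup; filter; cartesianProduct; allFin)
open import Data.Maybe using (Maybe; just; nothing; Is-just)
open import Data.Product using (_×_; _,_; ∃; Σ-syntax; ∃-syntax)
open import Relation.Binary.PropositionalEquality using (_≡_; _≢_)
open import Relation.Nullary using (¬_; yes; no)

-- A finite simple graph on vertex set Fin n, given by its list of edges
-- (each edge listed once, as a pair of distinct vertices).
record Graph : Set where
  field
    n     : ℕ
    edges : List (Fin n × Fin n)
open Graph public

size : Graph → ℕ
size G = length (edges G)

K : ℕ → Graph
K k = record
  { n = k
  ; edges = filter (λ e → toℕ (Data.Product.proj₁ e) <? toℕ (Data.Product.proj₂ e))
                   (cartesianProduct (allFin k) (allFin k)) }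

-- A position: a partial labeling (nothing = free vertex).
Position : Graph → Set
Position G = Fin (n G) → Maybe ℕ

empty : (G : Graph) → Position G
empty G _ = nothing

assign : (G : Graph) → Position G → Fin (n G) → ℕ → Position G
assign G p v l u with u ≟ v
... | yes _ = just l
... | no  _ = p u

edgeLabel : (G : Graph) → Position G → Fin (n G) × Fin (n G) → Maybe ℕ
edgeLabel G p (u , v) with p u | p v
... | just a | just b = just ∣ a - b ∣
... | _      | _      = nothing

EdgeLabelsDistinct : (G : Graph) → Position G → Set
EdgeLabelsDistinct G p =
  ∀ (i j : Fin (size G)) → i ≢ j → ∀ a b →
    edgeLabel G p (lookup (edges G) i) ≡ just a →
    edgeLabel G p (lookup (edges G) j) ≡ just b → a ≢ b

Legal : (G : Graph) → Position G → Fin (n G) → ℕ → Set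
Legal G p v l =
  (p v ≡ nothing) × (l ≤ size G) × (∀ u → p u ≢ just l) ×
  EdgeLabelsDistinct G (assign G p v l)

Complete : (G : Graph) → Position G → Set
Complete G p = ∀ v → Is-just (p v)

Graceful : (G : Graph) → Position G → Set
Graceful G p =
  Complete G p ×
  (∀ u v a → p u ≡ just a → p v ≡ just a → u ≡ v) ×
  (∀ u a → p u ≡ just a → a ≤ size G) ×
  EdgeLabelsDistinct G p

data Player : Set where
  alice bob : Player

-- The game ends when the player to move has no legal move (in particular
-- when every vertex is labeled); Alice wins iff the final labeling is graceful.

data AliceWins (G : Graph) : Player → Position G → Set where
  done      : ∀ {t p} → Graceful G p → AliceWins G t p
  aliceMove : ∀ {p} v l → Legal G p v l →
              AliceWins G bob (assign G p v l) → AliceWins G alice p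
  bobMove   : ∀ {p} → (∃[ v ] ∃[ l ] Legal G p v l) →
              (∀ v l → Legal G p v l → AliceWins G alice (assign G p v l)) →
              AliceWins G bob p

data BobWins (G : Graph) : Player → Position G → Set where
  stuck     : ∀ {t p} → ¬ Graceful G p → (∀ v l → ¬ Legal G p v l) → BobWins G t p
  bobMove   : ∀ {p} v l → Legal G p v l →
              BobWins G alice (assign G p v l) → BobWins G bob p
  aliceMove : ∀ {p} → (∃[ v ] ∃[ l ] Legal G p v l) →
              (∀ v l → Legal G p v l → BobWins G bob (assign G p v l)) →
              BobWins G alice p

-- Every move labels a free vertex with one of the labels 0, …, m, so the game
-- tree on Kₖ is finite and small; the winning strategies are found by
-- exhaustive search, which returns them as proof terms checked by evaluation.
-- On K₄ the only graceful label sets are {0,1,4,6} and {0,2,5,6}, so Bob wins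
-- by placing the label 3 as soon as it is his turn (unless Alice already has).
module Submission where

open import Defs
open import Data.Empty using (⊥-elim)
open import Data.Fin as Fin using (Fin; toℕ; fromℕ<)
open import Data.Fin.Properties using (all?; sequence; toℕ-fromℕ<)
open import Data.List using (head; mapMaybe; allFin; lookup)
open import Data.Maybe as Maybe using (Maybe; just; nothing; _<∣>_; _>>=_)
open import Data.Maybe.Effectful using (applicative)
import Data.Maybe.Properties as Maybe
import Data.Maybe.Relation.Unary.Any as Any
open import Data.Nat as ℕ using (ℕ; suc; _≤?_; s≤s)
open import Data.Product using (_×_; _,_; proj₁; proj₂)
open import Data.Unit using (tt)
open import Function using (_∘′_)
open import Relation.Nullary using (Dec; yes; no; ¬?)
open import Relation.Nullary.Decidable using (_×-dec_; _→-dec_; map′; dec⇒maybe)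
open import Relation.Binary.PropositionalEquality using (_≡_; _≢_; refl; subst; sym)
open import Relation.Unary using (Decidable)

firstJust : ∀ {k} {A : Set} → (Fin k → Maybe A) → Maybe A
firstJust f = head (mapMaybe f (allFin _))

allJust : ∀ {k} {P : Fin k → Set} → (∀ i → Maybe (P i)) → Maybe (∀ i → P i)
allJust = sequence applicative

whenDefined? : ∀ {P : ℕ → Set} → Decidable P →
               (x : Maybe ℕ) → Dec (∀ a → x ≡ just a → P a)
whenDefined? P? nothing  = yes λ _ ()
whenDefined? P? (just a) = map′ (λ { pa _ refl → pa }) (λ h → h a refl) (P? a)

distinctWhenDefined? : (x y : Maybe ℕ) →
                       Dec (∀ a b → x ≡ just a → y ≡ just b → a ≢ b)
distinctWhenDefined? x y =
  map′ (λ h a b x≡a y≡b → h a x≡a b y≡b) (λ h a x≡a b y≡b → h a b x≡a y≡b)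
       (whenDefined? (λ a → whenDefined? (λ b → ¬? (a ℕ.≟ b)) y) x)

module Search (G : Graph) where

  edgeLabelsDistinct? : (p : Position G) → Dec (EdgeLabelsDistinct G p)
  edgeLabelsDistinct? p = all? λ i → all? λ j →
    ¬? (i Fin.≟ j) →-dec
    distinctWhenDefined? (edgeLabel G p (lookup (edges G) i))
                         (edgeLabel G p (lookup (edges G) j))

  legal? : (p : Position G) (v : Fin (n G)) (l : ℕ) → Dec (Legal G p v l)
  legal? p v l =
    Maybe.≡-dec ℕ._≟_ (p v) nothing ×-dec
    (l ≤? size G) ×-dec
    all? (λ u → ¬? (Maybe.≡-dec ℕ._≟_ (p u) (just l))) ×-dec
    edgeLabelsDistinct? (assign G p v l)

  graceful? : (p : Position G) → Dec (Graceful G p)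
  graceful? p =
    all? (λ v → Any.dec (λ _ → yes tt) (p v)) ×-dec
    all? (λ u → all? λ v →
      whenDefined? (λ a → Maybe.≡-dec ℕ._≟_ (p v) (just a) →-dec (u Fin.≟ v)) (p u)) ×-dec
    all? (λ u → whenDefined? (_≤? size G) (p u)) ×-dec
    edgeLabelsDistinct? p

  -- Labels of legal moves are at most m, so it suffices to search labels in Fin (suc m).
  Label : Set
  Label = Fin (suc (size G))

  allLegal-fromLabels : ∀ {p} {X : Fin (n G) → ℕ → Set} →
    (∀ v (l : Label) → Legal G p v (toℕ l) → X v (toℕ l)) →
    ∀ v l → Legal G p v l → X v l
  allLegal-fromLabels {p} {X} h v l legal =
    subst (X v) (toℕ-fromℕ< l<)
      (h v (fromℕ< l<) (subst (Legal G p v) (sym (toℕ-fromℕ< l<)) legal))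
    where l< = s≤s (proj₁ (proj₂ legal))

  someLegalMove : ∀ {Y : Set} (p : Position G) →
    (∀ v l → Legal G p v l → Maybe Y) → Maybe Y
  someLegalMove p k = firstJust λ v → firstJust λ (l : Label) →
    dec⇒maybe (legal? p v (toℕ l)) >>= k v (toℕ l)

  everyLegalMove : ∀ {X : Fin (n G) → ℕ → Set} (p : Position G) →
    (∀ v l → Legal G p v l → Maybe (X v l)) → Maybe (∀ v l → Legal G p v l → X v l)
  everyLegalMove {X} p k =
    Maybe.map allLegal-fromLabels (allJust λ v → allJust λ (l : Label) → atMove v (toℕ l))
    where
    atMove : ∀ v l → Maybe (Legal G p v l → X v l)
    atMove v l with legal? p v l
    ... | yes legal = Maybe.map (λ x _ → x) (k v l legal)
    ... | no illegal = just (⊥-elim ∘′ illegal)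

  aliceWins? : ℕ → (t : Player) (p : Position G) → Maybe (AliceWins G t p)
  aliceStep  : ℕ → (t : Player) (p : Position G) → Maybe (AliceWins G t p)

  aliceWins? fuel t p = Maybe.map done (dec⇒maybe (graceful? p)) <∣> aliceStep fuel t p

  aliceStep 0          t     p = nothing
  aliceStep (suc fuel) alice p = someLegalMove p λ v l legal →
    Maybe.map (aliceMove v l legal) (aliceWins? fuel bob (assign G p v l))
  aliceStep (suc fuel) bob   p = do
    somemove ← someLegalMove p λ v l legal → just (v , l , legal)
    replies  ← everyLegalMove p λ v l _ → aliceWins? fuel alice (assign G p v l)
    just (bobMove somemove replies)

  bobWins? : ℕ → (t : Player) (p : Position G) → Maybe (BobWins G t p)
  bobStep  : ℕ → (t : Player) (p : Position G) → Maybe (BobWins G t p)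

  bobWins? fuel t p = gameOver <∣> bobStep fuel t p
    where
    gameOver : Maybe (BobWins G t p)
    gameOver with graceful? p
    ... | yes _ = nothing
    ... | no notGraceful = Maybe.map (stuck notGraceful) (everyLegalMove p λ _ _ _ → nothing)

  bobStep 0          t     p = nothing
  bobStep (suc fuel) bob   p = someLegalMove p λ v l legal →
    Maybe.map (bobMove v l legal) (bobWins? fuel alice (assign G p v l))
  bobStep (suc fuel) alice p = do
    somemove ← someLegalMove p λ v l legal → just (v , l , legal)
    replies  ← everyLegalMove p λ v l _ → bobWins? fuel bob (assign G p v l)
    just (aliceMove somemove replies)

open Search

aliceWinsK₃ : (first : Player) → AliceWins (K 3) first (empty (K 3))
aliceWinsK₃ alice = Maybe.from-just (aliceWins? (K 3) 3 alice (empty (K 3)))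
aliceWinsK₃ bob   = Maybe.from-just (aliceWins? (K 3) 3 bob (empty (K 3)))

bobWinsK₄ : (first : Player) → BobWins (K 4) first (empty (K 4))
bobWinsK₄ alice = Maybe.from-just (bobWins? (K 4) 4 alice (empty (K 4)))
bobWinsK₄ bob   = Maybe.from-just (bobWins? (K 4) 4 bob (empty (K 4)))

theorem2 : ((first : Player) → AliceWins (K 3) first (empty (K 3)))
         × ((first : Player) → BobWins (K 4) first (empty (K 4)))
theorem2 = aliceWinsK₃ , bobWinsK₄
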